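{- Let $q$ be an indeterminate, $[n]=1+q+\dots+q^{n-1}$, $[n]!=[1]\cdots[n]$, and let $e_n(q)$ be defined by the power product expansion $\exp_q(x)=\sum_{n\ge0}\frac{x^n}{[n]!}=\prod_{n\ge1}(1+e_n(q)x^n)$. Define $g_n(q)\in\mathbb{Z}[q]$ by $g_1(q)=1$, $g_{2^k}(q)=1-2^{k-1}q$ for $k\ge1$, $g_n(q)=0$ for even $n$ that are not powers of $2$, and $g_n(q)=-q$ for odd $n>1$. Then, working modulo $q^2$ (i.e. in $(\mathbb{Z}[q]/(q^2))[[x]]$, where the rational functions $1/[n]!$ and $e_n(q)$ have denominators with constant term $1$ and hence are power series in $q$ with rational coefficients), we have $e_n(q)\equiv g_n(q)\pmod{q^2}$ for all $n\ge1$, and $$\exp_q(x)\equiv 1+x+\sum_{n\ge2}(1-(n-1)q)x^n\equiv\prod_{n\ge1}(1+g_n(q)x^n)\pmod{q^2}.$$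
   Context: A power product expansion of a formal power series $f(x)=\sum_{n\ge0}a_nx^n$ with $a_0=1$ is the unique representation $f(x)=\prod_{n\ge1}(1+g_nx^n)$, here over $\mathbb{Q}(q)$. -}

module Defs where

open import Data.Nat as ℕ using (ℕ; zero; suc; _∸_)
import Data.Nat.Properties as ℕP
open import Data.Nat.Divisibility using (_∣_; _∣?_)
open import Data.Fin using (Fin; toℕ)
open import Data.Fin.Properties using (any?)
open import Data.Integer using (+_; -[1+_])
open import Data.Rational using (ℚ; 0ℚ; 1ℚ; _+_; _*_; -_; 1/_; ≢-nonZero)
open import Data.Rational.Properties using (_≟_)
open import Data.Product using (_×_; _,_; proj₁; proj₂)
open import Relation.Nullary using (yes; no)
open import Relation.Binary.PropositionalEquality using (_≡_)

-- The ring Q[q]/(q^2) of "dual numbers": (a , b) stands for a + b q.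
D : Set
D = ℚ × ℚ

fromℚ : ℚ → D
fromℚ a = (a , 0ℚ)

0D 1D qD : D
0D = (0ℚ , 0ℚ)
1D = (1ℚ , 0ℚ)
qD = (0ℚ , 1ℚ)

infixl 6 _+D_
infixl 7 _*D_
_+D_ : D → D → D
(a , b) +D (c , d) = (a + c , b + d)

_*D_ : D → D → D
(a , b) *D (c , d) = (a * c , a * d + b * c)

-D_ : D → D
-D (a , b) = (- a , - b)

ℕ→ℚ : ℕ → ℚ
ℕ→ℚ n = + n Data.Rational./ 1

qpow : ℕ → D
qpow zero    = 1D
qpow (suc i) = qpow i *D qD

qint : ℕ → D
qint zero    = 0D
qint (suc n) = qint n +D qpow n

qfact : ℕ → D
qfact zero    = 1D
qfact (suc n) = qfact n *D qint (suc n)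

-- Inverse in Q[q]/(q^2) of an element with nonzero constant term:
-- (a + b q)^{-1} = a^{-1} - b a^{-2} q.  (Junk value 0 if a = 0, never used.)
invD : D → D
invD (a , b) with a ≟ 0ℚ
... | yes _  = 0D
... | no a≢0 = let ia = 1/_ a {{≢-nonZero a≢0}} in (ia , - (b * (ia * ia)))

expq : ℕ → D
expq n = invD (qfact n)

Series : Set
Series = ℕ → D

-- s * (1 + c x^m)
mulBinom : Series → D → ℕ → Series
mulBinom s c m N with m ℕ.≤? N
... | yes _ = s N +D c *D s (N ∸ m)
... | no _  = s N

-- ∏_{k=1}^{M} (1 + e_k x^k), as a power series in x
ppProd : (ℕ → D) → ℕ → Series
ppProd e zero    zero    = 1D
ppProd e zero    (suc N) = 0D
ppProd e (suc M) = mulBinom (ppProd e M) (e (suc M)) (suc M)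

-- f(x) = ∏_{n≥1} (1 + e_n x^n): the coefficient of x^N of the infinite
-- product equals that of the finite product over 1 ≤ k ≤ N.
IsPPE : Series → (ℕ → D) → Set
IsPPE f e = ∀ N → ppProd e N N ≡ f N

g : ℕ → D
g zero = 0D
g (suc zero) = 1D
g (suc (suc n)) with 2 ∣? suc (suc n)
... | no _ = (0ℚ , - 1ℚ)
... | yes _ with any? {n = suc (suc (suc n))} (λ (k : Fin (suc (suc (suc n)))) → 2 ℕ.^ toℕ k ℕP.≟ suc (suc n))
...   | yes (k , _) = (1ℚ , - ℕ→ℚ (2 ℕ.^ (toℕ k ∸ 1)))
...   | no _        = 0D

module Submission where

-- Everything is computed in D = ℚ[q]/(q²).  Write emb c r = c - r·q for
-- natural numbers c, r; all coefficients occurring below have this shape.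
--
--  1. ℕ→ℚ is a semiring homomorphism, so one multiply-accumulate step on
--     elements emb c r is computed on the natural-number counts (emb-+*).
--  2. Mod q², [k] = 1 + q for k ≥ 2, hence [n+1]! = 1 + n q and
--     1/[n+1]! = 1 - n q (expq-suc).
--  3. Power product expansions are unique: the coefficient of x^N in the
--     product of the first N factors is that of the first N-1 factors
--     plus e_N (ppe-unique).
--  4. Closed form of the partial products ∏_{k≤M} (1 + g_k x^k).  With
--     P = pow2Above M the least power of two exceeding M, the coefficient
--     of x^N is emb [N < P] (R + [N < P]·⌊N/2⌋), where R counts the odd
--     k ∈ [3, M] with k ≤ N < k + P (closedForm-correct).  The q-free part is
--     ∏_j (1 + x^(2^j)) = 1 + x + … + x^(P-1); the q-part collects -q·x^k
--     for odd k and -2^(j-1) q·x^(2^j) for the powers of two.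
--  5. At M = N one has N < P, every odd k ≤ N counts, and
--     ⌊(N-1)/2⌋ + ⌊N/2⌋ = N - 1; so coefficient N equals expq N.

open import Defs
open import Data.Nat using (ℕ; suc; _≤_; _∸_)
open import Data.Rational using (1ℚ; -_)
open import Data.Product using (_×_; _,_)
open import Relation.Binary.PropositionalEquality using (_≡_)

open import Data.Nat as ℕ
  using (zero; _+_; _*_; _^_; _<_; z≤n; s≤s; _≤?_; _<?_; ⌊_/2⌋; ⌈_/2⌉)
open import Data.Nat.Properties
open import Data.Nat.Divisibility using (_∣_; _∣?_; divides; _∣0; ∣-refl; ∣⇒≤; ∣m∣n⇒∣m+n; ∣m+n∣m⇒∣n)
open import Data.Nat.Tactic.RingSolver using (solve-∀)
import Data.Integer as ℤ
import Data.Integer.Properties as ℤP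
open import Data.Rational as ℚ using (0ℚ; toℚᵘ)
import Data.Rational.Properties as ℚP
import Data.Rational.Unnormalised as ℚᵘ
import Data.Rational.Unnormalised.Properties as ℚᵘP
open import Data.Rational.Solver using (module +-*-Solver)
open import Algebra.Properties.Group ℚP.+-0-group using (∙-cancelˡ)
open import Data.Fin using (Fin; toℕ; fromℕ<)
open import Data.Fin.Properties using (any?; toℕ-fromℕ<)
open import Data.Product using (∃; proj₁; proj₂)
open import Data.Sum using (inj₁; inj₂)
open import Relation.Nullary using (Dec; yes; no; ¬_)
open import Relation.Nullary.Negation using (contradiction)
open import Relation.Binary.PropositionalEquality
  using (refl; sym; trans; cong; cong₂; subst; module ≡-Reasoning)

_/1 : ℕ → ℚᵘ.ℚᵘ
n /1 = ℚᵘ.mkℚᵘ (ℤ.+ n) 0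

toℚᵘ-ℕ→ℚ : ∀ n → toℚᵘ (ℕ→ℚ n) ℚᵘ.≃ n /1
toℚᵘ-ℕ→ℚ n = ℚP.toℚᵘ-fromℚᵘ (n /1)

/1-+ : ∀ m n → (m + n) /1 ℚᵘ.≃ (m /1) ℚᵘ.+ (n /1)
/1-+ m n = ℚᵘ.*≡* (begin
  ℤ.+ (m + n) ℤ.* ℤ.+ 1                             ≡⟨ ℤP.*-identityʳ _ ⟩
  ℤ.+ (m + n)                                       ≡⟨ ℤP.pos-+ m n ⟩
  ℤ.+ m ℤ.+ ℤ.+ n                                   ≡⟨ cong₂ ℤ._+_ (ℤP.*-identityʳ (ℤ.+ m)) (ℤP.*-identityʳ (ℤ.+ n)) ⟨
  ℤ.+ m ℤ.* ℤ.+ 1 ℤ.+ ℤ.+ n ℤ.* ℤ.+ 1               ≡⟨ ℤP.*-identityʳ _ ⟨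
  (ℤ.+ m ℤ.* ℤ.+ 1 ℤ.+ ℤ.+ n ℤ.* ℤ.+ 1) ℤ.* ℤ.+ 1   ∎)
  where open ≡-Reasoning

/1-* : ∀ m n → (m * n) /1 ℚᵘ.≃ (m /1) ℚᵘ.* (n /1)
/1-* m n = ℚᵘ.*≡* (begin
  ℤ.+ (m * n) ℤ.* ℤ.+ 1         ≡⟨ ℤP.*-identityʳ _ ⟩
  ℤ.+ (m * n)                   ≡⟨ ℤP.pos-* m n ⟩
  ℤ.+ m ℤ.* ℤ.+ n               ≡⟨ ℤP.*-identityʳ _ ⟨
  (ℤ.+ m ℤ.* ℤ.+ n) ℤ.* ℤ.+ 1   ∎)
  where open ≡-Reasoning

ℕ→ℚ-+ : ∀ m n → ℕ→ℚ (m + n) ≡ ℕ→ℚ m ℚ.+ ℕ→ℚ n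
ℕ→ℚ-+ m n = ℚP.toℚᵘ-injective (begin
  toℚᵘ (ℕ→ℚ (m + n))                    ≈⟨ toℚᵘ-ℕ→ℚ (m + n) ⟩
  (m + n) /1                            ≈⟨ /1-+ m n ⟩
  (m /1) ℚᵘ.+ (n /1)                    ≈⟨ ℚᵘP.+-cong (toℚᵘ-ℕ→ℚ m) (toℚᵘ-ℕ→ℚ n) ⟨
  toℚᵘ (ℕ→ℚ m) ℚᵘ.+ toℚᵘ (ℕ→ℚ n)       ≈⟨ ℚP.toℚᵘ-homo-+ (ℕ→ℚ m) (ℕ→ℚ n) ⟨
  toℚᵘ (ℕ→ℚ m ℚ.+ ℕ→ℚ n)               ∎)
  where open ℚᵘP.≃-Reasoning

ℕ→ℚ-* : ∀ m n → ℕ→ℚ (m * n) ≡ ℕ→ℚ m ℚ.* ℕ→ℚ n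
ℕ→ℚ-* m n = ℚP.toℚᵘ-injective (begin
  toℚᵘ (ℕ→ℚ (m * n))                    ≈⟨ toℚᵘ-ℕ→ℚ (m * n) ⟩
  (m * n) /1                            ≈⟨ /1-* m n ⟩
  (m /1) ℚᵘ.* (n /1)                    ≈⟨ ℚᵘP.*-cong (toℚᵘ-ℕ→ℚ m) (toℚᵘ-ℕ→ℚ n) ⟨
  toℚᵘ (ℕ→ℚ m) ℚᵘ.* toℚᵘ (ℕ→ℚ n)       ≈⟨ ℚP.toℚᵘ-homo-* (ℕ→ℚ m) (ℕ→ℚ n) ⟨
  toℚᵘ (ℕ→ℚ m ℚ.* ℕ→ℚ n)               ∎)
  where open ℚᵘP.≃-Reasoning

emb : ℕ → ℕ → D
emb c r = (ℕ→ℚ c , - ℕ→ℚ r)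

emb-+* : ∀ c r a b c′ r′ →
  emb c r +D emb a b *D emb c′ r′ ≡ emb (c + a * c′) (r + a * r′ + b * c′)
emb-+* c r a b c′ r′ = cong₂ _,_ constant linear
  where
  open ≡-Reasoning
  constant : ℕ→ℚ c ℚ.+ ℕ→ℚ a ℚ.* ℕ→ℚ c′ ≡ ℕ→ℚ (c + a * c′)
  constant = begin
    ℕ→ℚ c ℚ.+ ℕ→ℚ a ℚ.* ℕ→ℚ c′ ≡⟨ cong (ℕ→ℚ c ℚ.+_) (ℕ→ℚ-* a c′) ⟨
    ℕ→ℚ c ℚ.+ ℕ→ℚ (a * c′)     ≡⟨ ℕ→ℚ-+ c (a * c′) ⟨
    ℕ→ℚ (c + a * c′)           ∎
  negations : ∀ x y z u v → - x ℚ.+ (y ℚ.* - z ℚ.+ - u ℚ.* v) ≡ - (x ℚ.+ y ℚ.* z ℚ.+ u ℚ.* v)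
  negations = solve 5 (λ x y z u v → :- x :+ (y :* :- z :+ :- u :* v) := :- (x :+ y :* z :+ u :* v)) refl
    where open +-*-Solver
  linear : - ℕ→ℚ r ℚ.+ (ℕ→ℚ a ℚ.* - ℕ→ℚ r′ ℚ.+ - ℕ→ℚ b ℚ.* ℕ→ℚ c′)
         ≡ - ℕ→ℚ (r + a * r′ + b * c′)
  linear = begin
    - ℕ→ℚ r ℚ.+ (ℕ→ℚ a ℚ.* - ℕ→ℚ r′ ℚ.+ - ℕ→ℚ b ℚ.* ℕ→ℚ c′)
      ≡⟨ negations (ℕ→ℚ r) (ℕ→ℚ a) (ℕ→ℚ r′) (ℕ→ℚ b) (ℕ→ℚ c′) ⟩
    - (ℕ→ℚ r ℚ.+ ℕ→ℚ a ℚ.* ℕ→ℚ r′ ℚ.+ ℕ→ℚ b ℚ.* ℕ→ℚ c′)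
      ≡⟨ cong₂ (λ s t → - (ℕ→ℚ r ℚ.+ s ℚ.+ t)) (ℕ→ℚ-* a r′) (ℕ→ℚ-* b c′) ⟨
    - (ℕ→ℚ r ℚ.+ ℕ→ℚ (a * r′) ℚ.+ ℕ→ℚ (b * c′))
      ≡⟨ cong -_ (trans (ℕ→ℚ-+ (r + a * r′) (b * c′)) (cong (ℚ._+ ℕ→ℚ (b * c′)) (ℕ→ℚ-+ r (a * r′)))) ⟨
    - ℕ→ℚ (r + a * r′ + b * c′) ∎

*D-identityʳ : ∀ x → x *D 1D ≡ x
*D-identityʳ (a , b) = cong₂ _,_ (ℚP.*-identityʳ a) (begin
  a ℚ.* 0ℚ ℚ.+ b ℚ.* 1ℚ ≡⟨ cong₂ ℚ._+_ (ℚP.*-zeroʳ a) (ℚP.*-identityʳ b) ⟩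
  0ℚ ℚ.+ b              ≡⟨ ℚP.+-identityˡ b ⟩
  b                     ∎)
  where open ≡-Reasoning

+D-cancelˡ : ∀ x y z → x +D y ≡ x +D z → y ≡ z
+D-cancelˡ (a , b) (c , d) (c′ , d′) eq =
  cong₂ _,_ (∙-cancelˡ a c c′ (cong proj₁ eq)) (∙-cancelˡ b d d′ (cong proj₂ eq))

qpow-vanishes : ∀ n → qpow (suc (suc n)) ≡ 0D
qpow-vanishes zero    = refl
qpow-vanishes (suc n) = cong (_*D qD) (qpow-vanishes n)

qint-≥2 : ∀ n → qint (suc (suc n)) ≡ (1ℚ , 1ℚ)
qint-≥2 zero    = refl
qint-≥2 (suc n) = cong₂ _+D_ (qint-≥2 n) (qpow-vanishes n)

qfact-suc : ∀ n → qfact (suc n) ≡ (1ℚ , ℕ→ℚ n)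
qfact-suc zero    = refl
qfact-suc (suc n) = begin
  qfact (suc n) *D qint (suc (suc n)) ≡⟨ cong₂ _*D_ (qfact-suc n) (qint-≥2 n) ⟩
  (1ℚ , 1ℚ ℚ.+ ℕ→ℚ n ℚ.* 1ℚ)         ≡⟨ cong (λ t → (1ℚ , 1ℚ ℚ.+ t)) (ℚP.*-identityʳ (ℕ→ℚ n)) ⟩
  (1ℚ , 1ℚ ℚ.+ ℕ→ℚ n)                ≡⟨ cong (1ℚ ,_) (ℕ→ℚ-+ 1 n) ⟨
  (1ℚ , ℕ→ℚ (suc n))                 ∎
  where open ≡-Reasoning

expq-suc : ∀ n → expq (suc n) ≡ emb 1 n
expq-suc n = trans (cong invD (qfact-suc n)) (cong (λ t → (1ℚ , - t)) (ℚP.*-identityʳ (ℕ→ℚ n)))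

mulBinom-≤ : ∀ s c m N → m ≤ N → mulBinom s c m N ≡ s N +D c *D s (N ∸ m)
mulBinom-≤ s c m N m≤N with m ≤? N
... | yes _   = refl
... | no  m≰N = contradiction m≤N m≰N

mulBinom-> : ∀ s c m N → ¬ m ≤ N → mulBinom s c m N ≡ s N
mulBinom-> s c m N m≰N with m ≤? N
... | yes m≤N = contradiction m≤N m≰N
... | no  _   = refl

mulBinom-cong : ∀ {s s′} c m → (∀ N → s N ≡ s′ N) → ∀ N → mulBinom s c m N ≡ mulBinom s′ c m N
mulBinom-cong {s} {s′} c m s≗s′ N with m ≤? N
... | yes _ = cong₂ (λ u v → u +D c *D v) (s≗s′ N) (s≗s′ (N ∸ m))
... | no  _ = s≗s′ N

ppProd-const : ∀ e M → ppProd e M 0 ≡ 1D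
ppProd-const e zero    = refl
ppProd-const e (suc M) = ppProd-const e M

ppProd-top : ∀ e n → ppProd e (suc n) (suc n) ≡ ppProd e n (suc n) +D e (suc n) *D 1D
ppProd-top e n = begin
  ppProd e (suc n) (suc n)                              ≡⟨ mulBinom-≤ (ppProd e n) (e (suc n)) (suc n) (suc n) ≤-refl ⟩
  ppProd e n (suc n) +D e (suc n) *D ppProd e n (n ∸ n) ≡⟨ cong (λ k → ppProd e n (suc n) +D e (suc n) *D ppProd e n k) (n∸n≡0 n) ⟩
  ppProd e n (suc n) +D e (suc n) *D ppProd e n 0       ≡⟨ cong (λ y → ppProd e n (suc n) +D e (suc n) *D y) (ppProd-const e n) ⟩
  ppProd e n (suc n) +D e (suc n) *D 1D                 ∎
  where open ≡-Reasoning

ppProd-local : ∀ e e′ M → (∀ k → 1 ≤ k → k ≤ M → e k ≡ e′ k) → ∀ N → ppProd e M N ≡ ppProd e′ M N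
ppProd-local e e′ zero    _  zero    = refl
ppProd-local e e′ zero    _  (suc N) = refl
ppProd-local e e′ (suc M) e≗e′ N = begin
  mulBinom (ppProd e M) (e (suc M)) (suc M) N   ≡⟨ mulBinom-cong (e (suc M)) (suc M) (ppProd-local e e′ M below) N ⟩
  mulBinom (ppProd e′ M) (e (suc M)) (suc M) N  ≡⟨ cong (λ c → mulBinom (ppProd e′ M) c (suc M) N) (e≗e′ (suc M) (s≤s z≤n) ≤-refl) ⟩
  mulBinom (ppProd e′ M) (e′ (suc M)) (suc M) N ∎
  where
  open ≡-Reasoning
  below : ∀ k → 1 ≤ k → k ≤ M → e k ≡ e′ k
  below k 1≤k k≤M = e≗e′ k 1≤k (m≤n⇒m≤1+n k≤M)

ppe-unique : ∀ f e e′ → IsPPE f e → IsPPE f e′ → ∀ n → 1 ≤ n → e n ≡ e′ n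
ppe-unique f e e′ fe fe′ n 1≤n = agreeUpTo n n 1≤n ≤-refl
  where
  agreeUpTo : ∀ n k → 1 ≤ k → k ≤ n → e k ≡ e′ k
  agreeUpTo zero    k 1≤k k≤0 = contradiction (≤-trans 1≤k k≤0) λ ()
  agreeUpTo (suc n) k 1≤k k≤n+1 with m≤n⇒m<n∨m≡n k≤n+1
  ... | inj₁ k<n+1 = agreeUpTo n k 1≤k (≤-pred k<n+1)
  ... | inj₂ refl  = begin
    e k          ≡⟨ *D-identityʳ (e k) ⟨
    e k *D 1D    ≡⟨ +D-cancelˡ (ppProd e′ n k) (e k *D 1D) (e′ k *D 1D) top ⟩
    e′ k *D 1D   ≡⟨ *D-identityʳ (e′ k) ⟩
    e′ k         ∎
    where
    open ≡-Reasoning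
    -- Both sides are the coefficient of x^k = x^(n+1) of the expanded series.
    top : ppProd e′ n k +D e k *D 1D ≡ ppProd e′ n k +D e′ k *D 1D
    top = begin
      ppProd e′ n k +D e k *D 1D  ≡⟨ cong (_+D e k *D 1D) (ppProd-local e e′ n (agreeUpTo n) k) ⟨
      ppProd e n k +D e k *D 1D   ≡⟨ ppProd-top e n ⟨
      ppProd e k k                ≡⟨ trans (fe k) (sym (fe′ k)) ⟩
      ppProd e′ k k               ≡⟨ ppProd-top e′ n ⟩
      ppProd e′ n k +D e′ k *D 1D ∎

-- log₂⁺ m is the exponent of the least power of two exceeding m; it grows
-- exactly when m + 1 is a power of two.
log₂⁺ : ℕ → ℕ
log₂⁺ zero = 0
log₂⁺ (suc m) with suc m ≟ 2 ^ log₂⁺ m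
... | yes _ = suc (log₂⁺ m)
... | no  _ = log₂⁺ m

-- The least power of two exceeding m: the q-free part of ∏_{k≤m} (1 + g_k x^k)
-- is 1 + x + … + x^(pow2Above m - 1).
pow2Above : ℕ → ℕ
pow2Above m = 2 ^ log₂⁺ m

double : ∀ x → 2 * x ≡ x + x
double x = cong (λ y → x + y) (+-identityʳ x)

pow2Above-double : ∀ m → suc m ≡ pow2Above m → pow2Above (suc m) ≡ suc m + suc m
pow2Above-double m eq with suc m ≟ 2 ^ log₂⁺ m
... | yes _  = trans (double (pow2Above m)) (cong₂ _+_ (sym eq) (sym eq))
... | no  ne = contradiction eq ne

pow2Above-keep : ∀ m → ¬ suc m ≡ pow2Above m → pow2Above (suc m) ≡ pow2Above m
pow2Above-keep m ne with suc m ≟ 2 ^ log₂⁺ m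
... | yes eq = contradiction eq ne
... | no  _  = refl

pow2Above-> : ∀ m → m < pow2Above m
pow2Above-> zero    = s≤s z≤n
pow2Above-> (suc m) with suc m ≟ 2 ^ log₂⁺ m
... | yes eq = begin-strict
  suc m          <⟨ m<m+n (suc m) (s≤s z≤n) ⟩
  suc m + suc m  ≡⟨ cong₂ _+_ eq eq ⟩
  P + P          ≡⟨ double P ⟨
  2 * P          ∎
  where
  open ≤-Reasoning
  P = pow2Above m
... | no  ne = ≤∧≢⇒< (pow2Above-> m) ne

n<2^n : ∀ n → n < 2 ^ n
n<2^n zero    = s≤s z≤n
n<2^n (suc n) = begin-strict
  suc n          ≤⟨ n<2^n n ⟩
  2 ^ n          <⟨ m<m+n (2 ^ n) (m^n>0 2 n) ⟩
  2 ^ n + 2 ^ n  ≡⟨ double (2 ^ n) ⟨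
  2 ^ suc n      ∎
  where open ≤-Reasoning

2^-cancel-< : ∀ i j → 2 ^ i < 2 ^ j → i < j
2^-cancel-< i j 2^i<2^j = ≰⇒> (λ j≤i → <⇒≱ 2^i<2^j (^-monoʳ-≤ 2 j≤i))

pow2Above-least : ∀ m j → m < 2 ^ j → pow2Above m ≤ 2 ^ j
pow2Above-least zero    j _ = m^n>0 2 j
pow2Above-least (suc m) j m+1<2^j with suc m ≟ 2 ^ log₂⁺ m
... | yes eq = ^-monoʳ-≤ 2 (2^-cancel-< (log₂⁺ m) j (subst (_< 2 ^ j) eq m+1<2^j))
... | no  _  = pow2Above-least m j (<-trans (n<1+n m) m+1<2^j)

pow2Above-pred : ∀ m j → 2 ^ j ≡ suc m → pow2Above m ≡ suc m
pow2Above-pred m j eq = ≤-antisym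
  (subst (pow2Above m ≤_) eq (pow2Above-least m j (subst (m <_) (sym eq) (n<1+n m))))
  (pow2Above-> m)

pow2-even : ∀ j n → 2 ^ j ≡ suc (suc n) → 2 ∣ suc (suc n)
pow2-even zero    n ()
pow2-even (suc j) n eq = divides (2 ^ j) (trans (sym eq) (*-comm 2 (2 ^ j)))

pow2-halves : ∀ j n → 2 ^ j ≡ suc (suc n) → suc (suc n) ≡ 2 ^ (j ∸ 1) + 2 ^ (j ∸ 1)
pow2-halves zero    n ()
pow2-halves (suc j) n eq = trans (sym eq) (double (2 ^ j))

parity : ℕ → ℕ
parity zero          = 0
parity (suc zero)    = 1
parity (suc (suc n)) = parity n

parity-even : ∀ n → 2 ∣ n → parity n ≡ 0
parity-even zero          _     = refl
parity-even (suc zero)    2∣1   = contradiction (∣⇒≤ 2∣1) λ { (s≤s ()) }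
parity-even (suc (suc n)) 2∣n+2 = parity-even n (∣m+n∣m⇒∣n 2∣n+2 ∣-refl)

parity-odd : ∀ n → ¬ 2 ∣ n → parity n ≡ 1
parity-odd zero          2∤0   = contradiction (2 ∣0) 2∤0
parity-odd (suc zero)    _     = refl
parity-odd (suc (suc n)) 2∤n+2 = parity-odd n (λ 2∣n → 2∤n+2 (∣m∣n⇒∣m+n ∣-refl 2∣n))

-- Indicator of the odd numbers k ≥ 3, the indices with g_k = -q.
oddWeight : ℕ → ℕ
oddWeight zero          = 0
oddWeight (suc zero)    = 0
oddWeight (suc (suc n)) = parity n

⌊n/2⌋+parity : ∀ n → ⌊ n /2⌋ + parity n ≡ ⌈ n /2⌉
⌊n/2⌋+parity zero          = refl
⌊n/2⌋+parity (suc zero)    = refl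
⌊n/2⌋+parity (suc (suc n)) = cong suc (⌊n/2⌋+parity n)

oddCount-suc : ∀ m → ⌊ m ∸ 1 /2⌋ + oddWeight (suc m) ≡ ⌊ m /2⌋
oddCount-suc zero    = refl
oddCount-suc (suc n) = ⌊n/2⌋+parity n

half-+-double : ∀ K b → ⌊ K + (b + b) /2⌋ ≡ ⌊ K /2⌋ + b
half-+-double K zero    = trans (cong ⌊_/2⌋ (+-identityʳ K)) (sym (+-identityʳ ⌊ K /2⌋))
half-+-double K (suc b) = begin
  ⌊ K + (suc b + suc b) /2⌋    ≡⟨ cong ⌊_/2⌋ (two-more K b) ⟩
  suc ⌊ K + (b + b) /2⌋        ≡⟨ cong suc (half-+-double K b) ⟩
  suc (⌊ K /2⌋ + b)            ≡⟨ +-suc ⌊ K /2⌋ b ⟨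
  ⌊ K /2⌋ + suc b              ∎
  where
  open ≡-Reasoning
  two-more : ∀ K b → K + (suc b + suc b) ≡ suc (suc (K + (b + b)))
  two-more = solve-∀

𝟙 : {P : Set} → Dec P → ℕ
𝟙 (yes _) = 1
𝟙 (no  _) = 0

𝟙-yes : {P : Set} (d : Dec P) → P → 𝟙 d ≡ 1
𝟙-yes (yes _) _ = refl
𝟙-yes (no ¬p) p = contradiction p ¬p

𝟙-no : {P : Set} (d : Dec P) → ¬ P → 𝟙 d ≡ 0
𝟙-no (yes p) ¬p = contradiction p ¬p
𝟙-no (no  _) _  = refl

𝟙-⇔ : {P Q : Set} (d : Dec P) (d′ : Dec Q) → (P → Q) → (Q → P) → 𝟙 d ≡ 𝟙 d′
𝟙-⇔ (yes p) d′ to from = sym (𝟙-yes d′ (to p))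
𝟙-⇔ (no ¬p) d′ to from = sym (𝟙-no d′ (λ q → ¬p (from q)))

-- [N < p]: the coefficient of x^N in 1 + x + … + x^(p-1).
con : ℕ → ℕ → ℕ
con p N = 𝟙 (N <? p)

con-shift : ∀ k p N → k ≤ N → con (k + p) N ≡ con p (N ∸ k)
con-shift k p N k≤N = 𝟙-⇔ (N <? k + p) (N ∸ k <? p)
  (λ N<k+p → +-cancelˡ-< k (N ∸ k) p (subst (_< k + p) (sym (m+[n∸m]≡n k≤N)) N<k+p))
  (λ N∸k<p → subst (_< k + p) (m+[n∸m]≡n k≤N) (+-monoʳ-< k N∸k<p))

con-long : ∀ p p′ N → N < p → N < p′ → con p N ≡ con p′ N
con-long p p′ N N<p N<p′ = trans (𝟙-yes (N <? p) N<p) (sym (𝟙-yes (N <? p′) N<p′))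

-- [k ≤ N < k + p]: the coefficient of x^N in x^k (1 + x + … + x^(p-1)).
window : ℕ → ℕ → ℕ → ℕ
window k N p = 𝟙 (k ≤? N) * con (k + p) N

window-late : ∀ k N p → ¬ k ≤ N → window k N p ≡ 0
window-late k N p k≰N = cong (_* con (k + p) N) (𝟙-no (k ≤? N) k≰N)

window-shift : ∀ k N p → k ≤ N → window k N p ≡ con p (N ∸ k)
window-shift k N p k≤N = begin
  𝟙 (k ≤? N) * con (k + p) N ≡⟨ cong (_* con (k + p) N) (𝟙-yes (k ≤? N) k≤N) ⟩
  1 * con (k + p) N          ≡⟨ *-identityˡ _ ⟩
  con (k + p) N              ≡⟨ con-shift k p N k≤N ⟩
  con p (N ∸ k)              ∎
  where open ≡-Reasoning

window-long : ∀ k N p → N < p → window k N p ≡ 𝟙 (k ≤? N)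
window-long k N p N<p = trans
  (cong (𝟙 (k ≤? N) *_) (𝟙-yes (N <? k + p) (<-≤-trans N<p (m≤n+m p k))))
  (*-identityʳ _)

<-shift : ∀ M {K k} → K < k → M + K < k + M
<-shift M {K} {k} K<k = subst (M + K <_) (+-comm M k) (+-monoʳ-< M K<k)

-- If k ≤ K the first half misses N and
-- both other tests reduce to K < k + M; if k > K the second half misses N
-- while both long tests succeed.
window-split′ : ∀ k M K → window k (M + K) (M + M) ≡ window k (M + K) M + window k K M
window-split′ k M K with k ≤? K
... | yes k≤K
  rewrite 𝟙-yes (k ≤? M + K) (≤-trans k≤K (m≤n+m K M))
        | 𝟙-no (M + K <? k + M) (λ lt → <⇒≱ (+-cancelˡ-< M K k (subst (M + K <_) (+-comm k M) lt)) k≤K)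
  = cong (_+ 0) (𝟙-⇔ (M + K <? k + (M + M)) (K <? k + M)
      (λ lt → +-cancelˡ-< M K (k + M) (subst (M + K <_) (k+2M k M) lt))
      (λ lt → subst (M + K <_) (sym (k+2M k M)) (+-monoʳ-< M lt)))
  where
  k+2M : ∀ k M → k + (M + M) ≡ M + (k + M)
  k+2M = solve-∀
... | no k≰K
  rewrite 𝟙-yes (M + K <? k + M) (<-shift M (≰⇒> k≰K))
        | 𝟙-yes (M + K <? k + (M + M)) (<-≤-trans (<-shift M (≰⇒> k≰K)) (+-monoʳ-≤ k (m≤n+m M M)))
  = sym (+-identityʳ _)

window-split : ∀ k M N → M ≤ N → window k N (M + M) ≡ window k N M + window k (N ∸ M) M
window-split k M N M≤N = begin
  window k N (M + M)                   ≡⟨ cong (λ X → window k X (M + M)) N≡M+K ⟨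
  window k (M + K) (M + M)             ≡⟨ window-split′ k M K ⟩
  window k (M + K) M + window k K M    ≡⟨ cong (λ X → window k X M + window k K M) N≡M+K ⟩
  window k N M + window k K M          ∎
  where
  open ≡-Reasoning
  K = N ∸ M
  N≡M+K : M + K ≡ N
  N≡M+K = m+[n∸m]≡n M≤N

oddWindows : ℕ → ℕ → ℕ → ℕ
oddWindows zero    N p = 0
oddWindows (suc m) N p = oddWindows m N p + oddWeight (suc m) * window (suc m) N p

oddWindows-all : ∀ m N p → m ≤ N → N < p → oddWindows m N p ≡ ⌊ m ∸ 1 /2⌋
oddWindows-all zero    N p _       _   = refl
oddWindows-all (suc m) N p m+1≤N N<p = begin
  oddWindows m N p + oddWeight (suc m) * window (suc m) N p
    ≡⟨ cong₂ (λ x y → x + oddWeight (suc m) * y)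
         (oddWindows-all m N p (≤-trans (n≤1+n m) m+1≤N) N<p)
         (trans (window-long (suc m) N p N<p) (𝟙-yes (suc m ≤? N) m+1≤N)) ⟩
  ⌊ m ∸ 1 /2⌋ + oddWeight (suc m) * 1 ≡⟨ cong (λ y → ⌊ m ∸ 1 /2⌋ + y) (*-identityʳ _) ⟩
  ⌊ m ∸ 1 /2⌋ + oddWeight (suc m)     ≡⟨ oddCount-suc m ⟩
  ⌊ m /2⌋                             ∎
  where open ≡-Reasoning

oddWindows-long : ∀ m N p p′ → N < p → N < p′ → oddWindows m N p ≡ oddWindows m N p′
oddWindows-long zero    N p p′ _   _    = refl
oddWindows-long (suc m) N p p′ N<p N<p′ = cong₂ (λ x y → x + oddWeight (suc m) * y)
  (oddWindows-long m N p p′ N<p N<p′)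
  (trans (window-long (suc m) N p N<p) (sym (window-long (suc m) N p′ N<p′)))

oddWindows-split : ∀ m M N → M ≤ N → oddWindows m N (M + M) ≡ oddWindows m N M + oddWindows m (N ∸ M) M
oddWindows-split zero    M N _   = refl
oddWindows-split (suc m) M N M≤N = begin
  oddWindows m N (M + M) + w * window (suc m) N (M + M)
    ≡⟨ cong₂ (λ x y → x + w * y) (oddWindows-split m M N M≤N) (window-split (suc m) M N M≤N) ⟩
  oddWindows m N M + oddWindows m K M + w * (window (suc m) N M + window (suc m) K M)
    ≡⟨ regroup (oddWindows m N M) (oddWindows m K M) w (window (suc m) N M) (window (suc m) K M) ⟩
  oddWindows m N M + w * window (suc m) N M + (oddWindows m K M + w * window (suc m) K M) ∎
  where
  open ≡-Reasoning
  w = oddWeight (suc m)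
  K = N ∸ M
  regroup : ∀ a b c x y → a + b + c * (x + y) ≡ a + c * x + (b + c * y)
  regroup = solve-∀

Pow2Exponent : ℕ → Set
Pow2Exponent n = ∃ λ (k : Fin (suc (suc (suc n)))) → 2 ^ toℕ k ≡ suc (suc n)

g-odd : ∀ n → ¬ 2 ∣ suc (suc n) → g (suc (suc n)) ≡ emb 0 1
g-odd n 2∤M with 2 ∣? suc (suc n)
... | yes 2∣M = contradiction 2∣M 2∤M
... | no  _   = refl

g-even : ∀ n → 2 ∣ suc (suc n) → ¬ Pow2Exponent n → g (suc (suc n)) ≡ emb 0 0
g-even n 2∣M noExp with 2 ∣? suc (suc n)
... | no 2∤M = contradiction 2∣M 2∤M
... | yes _ with any? {n = suc (suc (suc n))} (λ (k : Fin (suc (suc (suc n)))) → 2 ^ toℕ k ≟ suc (suc n))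
...   | yes exp = contradiction exp noExp
...   | no  _   = refl

g-pow2 : ∀ n → 2 ∣ suc (suc n) → Pow2Exponent n →
  ∃ λ j → 2 ^ j ≡ suc (suc n) × g (suc (suc n)) ≡ emb 1 (2 ^ (j ∸ 1))
g-pow2 n 2∣M exp with 2 ∣? suc (suc n)
... | no 2∤M = contradiction 2∣M 2∤M
... | yes _ with any? {n = suc (suc (suc n))} (λ (k : Fin (suc (suc (suc n)))) → 2 ^ toℕ k ≟ suc (suc n))
...   | yes (k , 2^k≡M) = toℕ k , 2^k≡M , refl
...   | no  noExp       = contradiction exp noExp

-- What the factor 1 + g_M x^M (M = m + 1 ≥ 2) does to the closed form
-- below: odd M adds -q x^M, even M that is not a power of two does
-- nothing, and a power of two M = 2b doubles the q-free part and adds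
-- -b q x^M.
data FactorShape (m : ℕ) : Set where
  oddIndex  : g (suc m) ≡ emb 0 1 → oddWeight (suc m) ≡ 1 →
              pow2Above (suc m) ≡ pow2Above m → FactorShape m
  evenIndex : g (suc m) ≡ emb 0 0 → oddWeight (suc m) ≡ 0 →
              pow2Above (suc m) ≡ pow2Above m → FactorShape m
  pow2Index : ∀ b → suc m ≡ b + b → g (suc m) ≡ emb 1 b → oddWeight (suc m) ≡ 0 →
              pow2Above m ≡ suc m → FactorShape m

factorShape : ∀ n → FactorShape (suc n)
factorShape n with 2 ∣? suc (suc n)
... | no 2∤M = oddIndex (g-odd n 2∤M) (parity-odd (suc (suc n)) 2∤M)
    (pow2Above-keep (suc n) (λ eq → 2∤M (pow2-even (log₂⁺ (suc n)) n (sym eq))))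
... | yes 2∣M with any? {n = suc (suc (suc n))} (λ (k : Fin (suc (suc (suc n)))) → 2 ^ toℕ k ≟ suc (suc n))
...   | no noExp = evenIndex (g-even n 2∣M noExp) (parity-even (suc (suc n)) 2∣M)
    (pow2Above-keep (suc n) notPow2)
  where
  -- pow2Above (n + 1) = 2^j would be a power of two with j < n + 3.
  notPow2 : ¬ suc (suc n) ≡ pow2Above (suc n)
  notPow2 eq = noExp (fromℕ< j<n+3 , trans (cong (2 ^_) (toℕ-fromℕ< j<n+3)) (sym eq))
    where
    j<n+3 : log₂⁺ (suc n) < suc (suc (suc n))
    j<n+3 = <-trans (subst (log₂⁺ (suc n) <_) (sym eq) (n<2^n (log₂⁺ (suc n)))) (n<1+n _)
...   | yes exp with g-pow2 n 2∣M exp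
...     | j , 2^j≡M , gM = pow2Index (2 ^ (j ∸ 1)) (pow2-halves j n 2^j≡M) gM
    (parity-even (suc (suc n)) 2∣M) (pow2Above-pred (suc n) j 2^j≡M)

-- The q-part of the coefficient of x^N, when the q-free part is
-- 1 + x + … + x^(p-1): odd factors k ≤ m whose window contains N, plus
-- ⌊N/2⌋ from the powers of two (Σ_{j≥1} 2^(j-1)·(bit j of N) = ⌊N/2⌋).
lin : ℕ → ℕ → ℕ → ℕ
lin m p N = oddWindows m N p + con p N * ⌊ N /2⌋

closedForm : ℕ → ℕ → D
closedForm M N = emb (con (pow2Above M) N) (lin M (pow2Above M) N)

lin-odd : ∀ m p N → suc m ≤ N → oddWeight (suc m) ≡ 1 →
  lin m p N + 0 * lin m p (N ∸ suc m) + 1 * con p (N ∸ suc m) ≡ lin (suc m) p N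
lin-odd m p N M≤N w≡1 = begin
  oddWindows m N p + con p N * h + 0 + 1 * con p (N ∸ suc m)
    ≡⟨ cong (λ x → oddWindows m N p + con p N * h + 0 + 1 * x) (window-shift (suc m) N p M≤N) ⟨
  oddWindows m N p + con p N * h + 0 + 1 * window (suc m) N p
    ≡⟨ regroup (oddWindows m N p) (con p N * h) (window (suc m) N p) ⟩
  oddWindows m N p + 1 * window (suc m) N p + con p N * h
    ≡⟨ cong (λ w → oddWindows m N p + w * window (suc m) N p + con p N * h) w≡1 ⟨
  lin (suc m) p N ∎
  where
  open ≡-Reasoning
  h = ⌊ N /2⌋
  regroup : ∀ a b x → a + b + 0 + 1 * x ≡ a + 1 * x + b
  regroup = solve-∀

lin-even : ∀ m p N → oddWeight (suc m) ≡ 0 → ∀ r c →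
  lin m p N + 0 * r + 0 * c ≡ lin (suc m) p N
lin-even m p N w≡0 r c = begin
  oddWindows m N p + con p N * h + 0 + 0
    ≡⟨ regroup (oddWindows m N p) (con p N * h) (window (suc m) N p) ⟩
  oddWindows m N p + 0 * window (suc m) N p + con p N * h
    ≡⟨ cong (λ w → oddWindows m N p + w * window (suc m) N p + con p N * h) w≡0 ⟨
  lin (suc m) p N ∎
  where
  open ≡-Reasoning
  h = ⌊ N /2⌋
  regroup : ∀ a b x → a + b + 0 + 0 ≡ a + 0 * x + b
  regroup = solve-∀

lin-late : ∀ m p N → ¬ suc m ≤ N → lin (suc m) p N ≡ lin m p N
lin-late m p N M≰N = cong (λ x → x + con p N * ⌊ N /2⌋)
  (trans (cong (λ w → oddWindows m N p + oddWeight (suc m) * w) (window-late (suc m) N p M≰N))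
         (trans (cong (λ y → oddWindows m N p + y) (*-zeroʳ (oddWeight (suc m)))) (+-identityʳ _)))

lin-long : ∀ m p p′ N → N < p → N < p′ → lin m p N ≡ lin m p′ N
lin-long m p p′ N N<p N<p′ = cong₂ (λ x c → x + c * ⌊ N /2⌋)
  (oddWindows-long m N p p′ N<p N<p′) (con-long p p′ N N<p N<p′)

con-double : ∀ M N → M ≤ N → con M N + 1 * con M (N ∸ M) ≡ con (M + M) N
con-double M N M≤N = begin
  con M N + 1 * con M (N ∸ M) ≡⟨ cong₂ _+_ (𝟙-no (N <? M) (≤⇒≯ M≤N)) (*-identityˡ _) ⟩
  con M (N ∸ M)               ≡⟨ con-shift M M N M≤N ⟨
  con (M + M) N               ∎
  where open ≡-Reasoning

-- ... and its q-part: the two halves of the doubled window, plus b = M/2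
-- for every N < 2M with N ≥ M, which is what ⌊N/2⌋ - ⌊(N-M)/2⌋ accounts for.
lin-double : ∀ m b N → suc m ≡ b + b → oddWeight (suc m) ≡ 0 → suc m ≤ N →
  lin m (suc m) N + 1 * lin m (suc m) (N ∸ suc m) + b * con (suc m) (N ∸ suc m)
  ≡ lin (suc m) (suc m + suc m) N
lin-double m b N M≡2b w≡0 M≤N = begin
  oddWindows m N M + con M N * ⌊ N /2⌋ + 1 * (oddWindows m K M + c * ⌊ K /2⌋) + b * c
    ≡⟨ cong (λ x → oddWindows m N M + x * ⌊ N /2⌋ + 1 * (oddWindows m K M + c * ⌊ K /2⌋) + b * c)
         (𝟙-no (N <? M) (≤⇒≯ M≤N)) ⟩
  oddWindows m N M + 0 * ⌊ N /2⌋ + 1 * (oddWindows m K M + c * ⌊ K /2⌋) + b * c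
    ≡⟨ regroup (oddWindows m N M) (⌊ N /2⌋) (oddWindows m K M) c (⌊ K /2⌋) b (window M N (M + M)) ⟩
  oddWindows m N M + oddWindows m K M + 0 * window M N (M + M) + c * (⌊ K /2⌋ + b)
    ≡⟨ cong₂ (λ x y → x + 0 * window M N (M + M) + c * y) (oddWindows-split m M N M≤N) halves ⟨
  oddWindows m N (M + M) + 0 * window M N (M + M) + c * ⌊ N /2⌋
    ≡⟨ cong₂ (λ w x → oddWindows m N (M + M) + w * window M N (M + M) + x * ⌊ N /2⌋)
         w≡0 (con-shift M M N M≤N) ⟨
  lin M (M + M) N ∎
  where
  open ≡-Reasoning
  M = suc m
  K = N ∸ M
  c = con M K
  halves : ⌊ N /2⌋ ≡ ⌊ K /2⌋ + b
  halves = begin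
    ⌊ N /2⌋            ≡⟨ cong ⌊_/2⌋ (m∸n+n≡m M≤N) ⟨
    ⌊ K + M /2⌋        ≡⟨ cong (λ x → ⌊ K + x /2⌋) M≡2b ⟩
    ⌊ K + (b + b) /2⌋  ≡⟨ half-+-double K b ⟩
    ⌊ K /2⌋ + b        ∎
  regroup : ∀ r h r′ c h′ b w → r + 0 * h + 1 * (r′ + c * h′) + b * c ≡ r + r′ + 0 * w + c * (h′ + b)
  regroup = solve-∀

closed-mul : ∀ m N a b → g (suc m) ≡ emb a b →
  closedForm m N +D g (suc m) *D closedForm m (N ∸ suc m)
  ≡ emb (con (pow2Above m) N + a * con (pow2Above m) (N ∸ suc m))
        (lin m (pow2Above m) N + a * lin m (pow2Above m) (N ∸ suc m) + b * con (pow2Above m) (N ∸ suc m))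
closed-mul m N a b gM = trans
  (cong (λ x → closedForm m N +D x *D closedForm m (N ∸ suc m)) gM)
  (emb-+* (con p N) (lin m p N) a b (con p (N ∸ suc m)) (lin m p (N ∸ suc m)))
  where
  p = pow2Above m

closed-step : ∀ m N → suc m ≤ N → FactorShape m →
  closedForm m N +D g (suc m) *D closedForm m (N ∸ suc m) ≡ closedForm (suc m) N
closed-step m N M≤N (oddIndex gM w≡1 samePow) = begin
  closedForm m N +D g (suc m) *D closedForm m (N ∸ suc m)       ≡⟨ closed-mul m N 0 1 gM ⟩
  emb (con p N + 0) (lin m p N + 0 * lin m p K + 1 * con p K)   ≡⟨ cong₂ emb (+-identityʳ (con p N)) (lin-odd m p N M≤N w≡1) ⟩
  emb (con p N) (lin (suc m) p N)                                ≡⟨ cong (λ p → emb (con p N) (lin (suc m) p N)) samePow ⟨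
  closedForm (suc m) N                                           ∎
  where
  open ≡-Reasoning
  p = pow2Above m
  K = N ∸ suc m
closed-step m N M≤N (evenIndex gM w≡0 samePow) = begin
  closedForm m N +D g (suc m) *D closedForm m (N ∸ suc m)       ≡⟨ closed-mul m N 0 0 gM ⟩
  emb (con p N + 0) (lin m p N + 0 * lin m p K + 0 * con p K)   ≡⟨ cong₂ emb (+-identityʳ (con p N)) (lin-even m p N w≡0 (lin m p K) (con p K)) ⟩
  emb (con p N) (lin (suc m) p N)                                ≡⟨ cong (λ p → emb (con p N) (lin (suc m) p N)) samePow ⟨
  closedForm (suc m) N                                           ∎
  where
  open ≡-Reasoning
  p = pow2Above m
  K = N ∸ suc m
closed-step m N M≤N (pow2Index b M≡2b gM w≡0 p≡M) = begin
  closedForm m N +D g M *D closedForm m K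
    ≡⟨ closed-mul m N 1 b gM ⟩
  emb (con p N + 1 * con p K) (lin m p N + 1 * lin m p K + b * con p K)
    ≡⟨ cong (λ p → emb (con p N + 1 * con p K) (lin m p N + 1 * lin m p K + b * con p K)) p≡M ⟩
  emb (con M N + 1 * con M K) (lin m M N + 1 * lin m M K + b * con M K)
    ≡⟨ cong₂ emb (con-double M N M≤N) (lin-double m b N M≡2b w≡0 M≤N) ⟩
  emb (con (M + M) N) (lin M (M + M) N)
    ≡⟨ cong (λ p → emb (con p N) (lin M p N)) (pow2Above-double m (sym p≡M)) ⟨
  closedForm M N ∎
  where
  open ≡-Reasoning
  M = suc m
  K = N ∸ M
  p = pow2Above m

closed-late-samePow : ∀ m N → ¬ suc m ≤ N → pow2Above (suc m) ≡ pow2Above m →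
  closedForm m N ≡ closedForm (suc m) N
closed-late-samePow m N M≰N samePow = trans
  (cong (emb (con (pow2Above m) N)) (sym (lin-late m (pow2Above m) N M≰N)))
  (cong (λ p → emb (con p N) (lin (suc m) p N)) (sym samePow))

closed-late : ∀ m N → ¬ suc m ≤ N → FactorShape m → closedForm m N ≡ closedForm (suc m) N
closed-late m N M≰N (oddIndex  _ _ samePow) = closed-late-samePow m N M≰N samePow
closed-late m N M≰N (evenIndex _ _ samePow) = closed-late-samePow m N M≰N samePow
closed-late m N M≰N (pow2Index b _ _ _ p≡M) = begin
  emb (con p N) (lin m p N)           ≡⟨ cong₂ emb (con-long p p′ N N<p N<p′) (lin-long m p p′ N N<p N<p′) ⟩
  emb (con p′ N) (lin m p′ N)         ≡⟨ cong (emb (con p′ N)) (lin-late m p′ N M≰N) ⟨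
  emb (con p′ N) (lin (suc m) p′ N)   ∎
  where
  open ≡-Reasoning
  p  = pow2Above m
  p′ = pow2Above (suc m)
  N<p : N < p
  N<p = subst (N <_) (sym p≡M) (≰⇒> M≰N)
  N<p′ : N < p′
  N<p′ = subst (N <_) (sym (pow2Above-double m (sym p≡M))) (<-≤-trans (≰⇒> M≰N) (m≤m+n (suc m) (suc m)))

closedForm-extend : ∀ n N → Dec (suc (suc n) ≤ N) →
  (∀ N′ → ppProd g (suc n) N′ ≡ closedForm (suc n) N′) →
  ppProd g (suc (suc n)) N ≡ closedForm (suc (suc n)) N
closedForm-extend n N (yes M≤N) ih = begin
  ppProd g M N                                              ≡⟨ mulBinom-≤ (ppProd g (suc n)) (g M) M N M≤N ⟩
  ppProd g (suc n) N +D g M *D ppProd g (suc n) (N ∸ M)     ≡⟨ cong₂ (λ u v → u +D g M *D v) (ih N) (ih (N ∸ M)) ⟩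
  closedForm (suc n) N +D g M *D closedForm (suc n) (N ∸ M) ≡⟨ closed-step (suc n) N M≤N (factorShape n) ⟩
  closedForm M N                                            ∎
  where
  open ≡-Reasoning
  M = suc (suc n)
closedForm-extend n N (no M≰N) ih = begin
  ppProd g M N         ≡⟨ mulBinom-> (ppProd g (suc n)) (g M) M N M≰N ⟩
  ppProd g (suc n) N   ≡⟨ ih N ⟩
  closedForm (suc n) N ≡⟨ closed-late (suc n) N M≰N (factorShape n) ⟩
  closedForm M N       ∎
  where
  open ≡-Reasoning
  M = suc (suc n)

closedForm-correct : ∀ M N → ppProd g M N ≡ closedForm M N
closedForm-correct zero          zero          = refl
closedForm-correct zero          (suc N)       = refl
closedForm-correct (suc zero)    zero          = refl
closedForm-correct (suc zero)    (suc zero)    = refl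
closedForm-correct (suc zero)    (suc (suc N)) = refl
closedForm-correct (suc (suc n)) N             =
  closedForm-extend n N (suc (suc n) ≤? N) (closedForm-correct (suc n))

-- On the diagonal every odd k ≤ N counts: ⌊(N-1)/2⌋ + ⌊N/2⌋ = N - 1.
closedForm-diagonal : ∀ n → closedForm (suc n) (suc n) ≡ emb 1 n
closedForm-diagonal n = cong₂ emb in-block (begin
  oddWindows (suc n) (suc n) P + con P (suc n) * ⌊ suc n /2⌋
    ≡⟨ cong₂ (λ x c → x + c * ⌊ suc n /2⌋) (oddWindows-all (suc n) (suc n) P ≤-refl N<P) in-block ⟩
  ⌊ n /2⌋ + 1 * ⌊ suc n /2⌋ ≡⟨ cong (λ y → ⌊ n /2⌋ + y) (*-identityˡ _) ⟩
  ⌊ n /2⌋ + ⌈ n /2⌉         ≡⟨ ⌊n/2⌋+⌈n/2⌉≡n n ⟩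
  n                         ∎)
  where
  open ≡-Reasoning
  P = pow2Above (suc n)
  N<P : suc n < P
  N<P = pow2Above-> (suc n)
  in-block : con P (suc n) ≡ 1
  in-block = 𝟙-yes (suc n <? P) N<P

g-expansion : IsPPE expq g
g-expansion zero    = refl
g-expansion (suc n) = trans (closedForm-correct (suc n) (suc n))
                            (trans (closedForm-diagonal n) (sym (expq-suc n)))

expq-closed : ∀ n → 1 ≤ n → expq n ≡ (1ℚ , - ℕ→ℚ (n ∸ 1))
expq-closed (suc n) _ = expq-suc n

theorem4p5 : (e : ℕ → D) → IsPPE expq e →
    ((n : ℕ) → 1 ≤ n → e n ≡ g n)
    × (expq 0 ≡ 1D × expq 1 ≡ 1D
       × ((n : ℕ) → 2 ≤ n → expq n ≡ (1ℚ , - ℕ→ℚ (n ∸ 1))))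
    × IsPPE expq g
theorem4p5 e e-expansion =
    ppe-unique expq e g e-expansion g-expansion
  , (refl , refl , λ n 2≤n → expq-closed n (≤-trans (s≤s z≤n) 2≤n))
  , g-expansion
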